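{- Let $t\geq 3$ be fixed and let $\mathcal{G}$ be the class of $\{K_{1,t},\text{diamond}\}$-free graphs. Let $G$ be a graph that contains an induced diamond. Let $S\subseteq V(G)$ be an independent set of $G$ such that $G\oplus S\in\mathcal{G}$. Then $S$ is exactly the set of all vertices that are degree-2 vertices of some induced diamond in $G$.
   Context: All graphs are finite and simple. For a graph $G$ and $S\subseteq V(G)$, $G\oplus S$ is the graph on $V(G)$ obtained by complementing the subgraph induced by $S$: $uv$ is an edge of $G\oplus S$ iff either $u,v\in S$ and $uv$ is a nonedge of $G$, or $uv$ is an edge of $G$ and $\{u,v\}\setminus S\neq\emptyset$. The diamond is $K_4$ minus one edge; its degree-2 vertices are the two nonadjacent vertices. $K_{1,t}$ is the star with a center of degree $t$ and $t$ leaves. A graph is $\mathcal{H}$-free if it has no induced subgraph isomorphic to a member of $\mathcal{H}$. -}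

module Defs where

open import Data.Nat using (ℕ; suc)
open import Data.Fin using (Fin; zero; suc; _≟_)
open import Data.Bool using (Bool; true; false; not; _∧_; if_then_else_)
open import Data.Product using (Σ; ∃; _×_; _,_)
open import Relation.Nullary using (¬_; yes; no)
open import Relation.Binary.PropositionalEquality using (_≡_; refl; sym)
open import Function.Definitions using (Injective)

record Graph (n : ℕ) : Set where
  field
    adj    : Fin n → Fin n → Bool
    adj-sym : ∀ u v → adj u v ≡ adj v u
    irrefl : ∀ u → adj u u ≡ false
open Graph public

VSet : ℕ → Set
VSet n = Fin n → Bool

IsInducedCopy : ∀ {k n} → Graph k → Graph n → (Fin k → Fin n) → Set
IsInducedCopy H G f = Injective _≡_ _≡_ f × (∀ i j → adj G (f i) (f j) ≡ adj H i j)

ContainsInduced : ∀ {k n} → Graph k → Graph n → Set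
ContainsInduced {k} {n} H G = Σ (Fin k → Fin n) λ f → IsInducedCopy H G f

-- Diamond = K4 minus the edge {0,1}; vertices 0 and 1 are its degree-2 vertices.
private
  dadj : Fin 4 → Fin 4 → Bool
  dadj zero zero = false
  dadj zero (suc zero) = false
  dadj (suc zero) zero = false
  dadj (suc zero) (suc zero) = false
  dadj (suc (suc zero)) (suc (suc zero)) = false
  dadj (suc (suc (suc zero))) (suc (suc (suc zero))) = false
  dadj _ _ = true

  dsym : ∀ u v → dadj u v ≡ dadj v u
  dsym zero zero = refl
  dsym zero (suc zero) = refl
  dsym zero (suc (suc zero)) = refl
  dsym zero (suc (suc (suc zero))) = refl
  dsym (suc zero) zero = refl
  dsym (suc zero) (suc zero) = refl
  dsym (suc zero) (suc (suc zero)) = refl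
  dsym (suc zero) (suc (suc (suc zero))) = refl
  dsym (suc (suc zero)) zero = refl
  dsym (suc (suc zero)) (suc zero) = refl
  dsym (suc (suc zero)) (suc (suc zero)) = refl
  dsym (suc (suc zero)) (suc (suc (suc zero))) = refl
  dsym (suc (suc (suc zero))) zero = refl
  dsym (suc (suc (suc zero))) (suc zero) = refl
  dsym (suc (suc (suc zero))) (suc (suc zero)) = refl
  dsym (suc (suc (suc zero))) (suc (suc (suc zero))) = refl

  dirr : ∀ u → dadj u u ≡ false
  dirr zero = refl
  dirr (suc zero) = refl
  dirr (suc (suc zero)) = refl
  dirr (suc (suc (suc zero))) = refl

diamond : Graph 4
diamond = record { adj = dadj ; adj-sym = dsym ; irrefl = dirr }

private
  sadj : ∀ {t} → Fin (suc t) → Fin (suc t) → Bool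
  sadj zero zero = false
  sadj zero (suc _) = true
  sadj (suc _) zero = true
  sadj (suc _) (suc _) = false

  ssym : ∀ {t} (u v : Fin (suc t)) → sadj u v ≡ sadj v u
  ssym zero zero = refl
  ssym zero (suc _) = refl
  ssym (suc _) zero = refl
  ssym (suc _) (suc _) = refl

  sirr : ∀ {t} (u : Fin (suc t)) → sadj u u ≡ false
  sirr zero = refl
  sirr (suc _) = refl

star : (t : ℕ) → Graph (suc t)
star t = record { adj = sadj ; adj-sym = ssym ; irrefl = sirr }

private
  flip : ∀ {n} → Graph n → VSet n → Fin n → Fin n → Bool
  flip G S u v with u ≟ v
  ... | yes _ = false
  ... | no _ = if S u ∧ S v then not (adj G u v) else adj G u v

  ∧-comm : ∀ a b → a ∧ b ≡ b ∧ a
  ∧-comm false false = refl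
  ∧-comm false true = refl
  ∧-comm true false = refl
  ∧-comm true true = refl

  flip-sym : ∀ {n} (G : Graph n) (S : VSet n) u v → flip G S u v ≡ flip G S v u
  flip-sym G S u v with u ≟ v | v ≟ u
  ... | yes _ | yes _ = refl
  ... | yes p | no q = Data.Empty.⊥-elim (q (sym p))
    where import Data.Empty
  ... | no p | yes q = Data.Empty.⊥-elim (p (sym q))
    where import Data.Empty
  ... | no _ | no _ rewrite ∧-comm (S u) (S v) | Graph.adj-sym G u v = refl

  flip-irr : ∀ {n} (G : Graph n) (S : VSet n) u → flip G S u u ≡ false
  flip-irr G S u with u ≟ u
  ... | yes _ = refl
  ... | no p = Data.Empty.⊥-elim (p refl)
    where import Data.Empty

_⊕_ : ∀ {n} → Graph n → VSet n → Graph n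
G ⊕ S = record { adj = flip G S ; adj-sym = flip-sym G S ; irrefl = flip-irr G S }

Independent : ∀ {n} → Graph n → VSet n → Set
Independent G S = ∀ u v → S u ≡ true → S v ≡ true → adj G u v ≡ false

StarDiamondFree : ℕ → ∀ {n} → Graph n → Set
StarDiamondFree t G = ¬ ContainsInduced (star t) G × ¬ ContainsInduced diamond G

DiamondDeg2 : ∀ {n} → Graph n → Fin n → Set
DiamondDeg2 {n} G v = Σ (Fin 4 → Fin n) λ f →
  IsInducedCopy diamond G f × ((f zero ≡ v) Data.Sum.⊎ (f (suc zero) ≡ v))
  where import Data.Sum

{-# OPTIONS --safe #-}
module Submission where

-- Complementing an independent set S keeps every edge of G, and a pair is
-- changed only if both ends lie in S, where it becomes an edge.  So an induced
-- diamond of G whose degree-2 vertex a is outside S survives in G ⊕ S; hence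
-- both degree-2 vertices of every induced diamond of G lie in S.  Conversely,
-- given v ∈ S and an induced diamond a, b, c, d of G (with a, b ∈ S and
-- c, d ∉ S), either v is adjacent to both c and d, and then v, a, c, d is an
-- induced diamond of G with v of degree 2, or one of v, d, a, c / v, c, a, d /
-- v, c, a, b is an induced diamond of G ⊕ S.

open import Defs
open import Data.Nat using (ℕ; _≥_)
open import Data.Fin using (Fin; zero; suc; _≟_)
open import Data.Fin.Properties using (0≢1+n)
open import Data.Bool using (true; false)
open import Data.Vec using (_∷_; []; lookup)
open import Data.Product using (_,_)
open import Data.Sum using (inj₁; inj₂)
open import Data.Empty using (⊥-elim)
open import Function using (_∘_)
open import Function.Bundles using (_⇔_; mk⇔)
open import Relation.Nullary using (¬_; yes; no)
open import Relation.Binary.PropositionalEquality using (_≡_; _≢_; refl; sym; trans)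

module _ {n : ℕ} (K : Graph n) where

  adj-flip : ∀ {u v b} → adj K u v ≡ b → adj K v u ≡ b
  adj-flip {u} {v} e = trans (adj-sym K v u) e

  adj⇒≢ : ∀ {u v} → adj K u v ≡ true → u ≢ v
  adj⇒≢ {u} e refl with trans (sym e) (irrefl K u)
  ... | ()

record DiamondOn {n : ℕ} (K : Graph n) (a b c d : Fin n) : Set where
  field
    a≢b : a ≢ b
    a≁b : adj K a b ≡ false
    a∼c : adj K a c ≡ true
    a∼d : adj K a d ≡ true
    b∼c : adj K b c ≡ true
    b∼d : adj K b d ≡ true
    c∼d : adj K c d ≡ true

module _ {n : ℕ} {K : Graph n} {a b c d : Fin n} (D : DiamondOn K a b c d) where
  open DiamondOn D

  DiamondOn-swap : DiamondOn K b a c d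
  DiamondOn-swap = record
    { a≢b = a≢b ∘ sym ; a≁b = adj-flip K a≁b
    ; a∼c = b∼c ; a∼d = b∼d ; b∼c = a∼c ; b∼d = a∼d ; c∼d = c∼d }

  DiamondOn⇒IsInducedCopy : IsInducedCopy diamond K (lookup (a ∷ b ∷ c ∷ d ∷ []))
  DiamondOn⇒IsInducedCopy = injective , adjacency
    where
    injective : ∀ {i j} → lookup (a ∷ b ∷ c ∷ d ∷ []) i ≡ lookup (a ∷ b ∷ c ∷ d ∷ []) j → i ≡ j
    injective {zero}                {zero}                _ = refl
    injective {zero}                {suc zero}            q = ⊥-elim (a≢b q)
    injective {zero}                {suc (suc zero)}      q = ⊥-elim (adj⇒≢ K a∼c q)
    injective {zero}                {suc (suc (suc zero))} q = ⊥-elim (adj⇒≢ K a∼d q)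
    injective {suc zero}            {zero}                q = ⊥-elim (a≢b (sym q))
    injective {suc zero}            {suc zero}            _ = refl
    injective {suc zero}            {suc (suc zero)}      q = ⊥-elim (adj⇒≢ K b∼c q)
    injective {suc zero}            {suc (suc (suc zero))} q = ⊥-elim (adj⇒≢ K b∼d q)
    injective {suc (suc zero)}      {zero}                q = ⊥-elim (adj⇒≢ K a∼c (sym q))
    injective {suc (suc zero)}      {suc zero}            q = ⊥-elim (adj⇒≢ K b∼c (sym q))
    injective {suc (suc zero)}      {suc (suc zero)}      _ = refl
    injective {suc (suc zero)}      {suc (suc (suc zero))} q = ⊥-elim (adj⇒≢ K c∼d q)
    injective {suc (suc (suc zero))} {zero}               q = ⊥-elim (adj⇒≢ K a∼d (sym q))
    injective {suc (suc (suc zero))} {suc zero}           q = ⊥-elim (adj⇒≢ K b∼d (sym q))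
    injective {suc (suc (suc zero))} {suc (suc zero)}     q = ⊥-elim (adj⇒≢ K c∼d (sym q))
    injective {suc (suc (suc zero))} {suc (suc (suc zero))} _ = refl

    adjacency : ∀ i j → adj K (lookup (a ∷ b ∷ c ∷ d ∷ []) i) (lookup (a ∷ b ∷ c ∷ d ∷ []) j)
                      ≡ adj diamond i j
    adjacency zero                  zero                  = irrefl K a
    adjacency zero                  (suc zero)            = a≁b
    adjacency zero                  (suc (suc zero))      = a∼c
    adjacency zero                  (suc (suc (suc zero))) = a∼d
    adjacency (suc zero)            zero                  = adj-flip K a≁b
    adjacency (suc zero)            (suc zero)            = irrefl K b
    adjacency (suc zero)            (suc (suc zero))      = b∼c
    adjacency (suc zero)            (suc (suc (suc zero))) = b∼d
    adjacency (suc (suc zero))      zero                  = adj-flip K a∼c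
    adjacency (suc (suc zero))      (suc zero)            = adj-flip K b∼c
    adjacency (suc (suc zero))      (suc (suc zero))      = irrefl K c
    adjacency (suc (suc zero))      (suc (suc (suc zero))) = c∼d
    adjacency (suc (suc (suc zero))) zero                 = adj-flip K a∼d
    adjacency (suc (suc (suc zero))) (suc zero)           = adj-flip K b∼d
    adjacency (suc (suc (suc zero))) (suc (suc zero))     = adj-flip K c∼d
    adjacency (suc (suc (suc zero))) (suc (suc (suc zero))) = irrefl K d

IsInducedCopy⇒DiamondOn : ∀ {n} {K : Graph n} {f : Fin 4 → Fin n} → IsInducedCopy diamond K f →
  DiamondOn K (f zero) (f (suc zero)) (f (suc (suc zero))) (f (suc (suc (suc zero))))
IsInducedCopy⇒DiamondOn {f = f} (injective , adjacency) = record
  { a≢b = 0≢1+n ∘ injective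
  ; a≁b = adjacency zero (suc zero)
  ; a∼c = adjacency zero (suc (suc zero))
  ; a∼d = adjacency zero (suc (suc (suc zero)))
  ; b∼c = adjacency (suc zero) (suc (suc zero))
  ; b∼d = adjacency (suc zero) (suc (suc (suc zero)))
  ; c∼d = adjacency (suc (suc zero)) (suc (suc (suc zero))) }

module _ {n : ℕ} (G : Graph n) (S : VSet n) where

  ⊕-unchangedˡ : ∀ {u v} → S u ≡ false → adj (G ⊕ S) u v ≡ adj G u v
  ⊕-unchangedˡ {u} {v} u∉S with u ≟ v
  ... | yes refl = sym (irrefl G u)
  ... | no _ rewrite u∉S = refl

  ⊕-unchangedʳ : ∀ {u v} → S v ≡ false → adj (G ⊕ S) u v ≡ adj G u v
  ⊕-unchangedʳ {u} {v} v∉S = adj-flip (G ⊕ S) {v} {u} (trans (⊕-unchangedˡ v∉S) (adj-sym G v u))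

  module _ (independent : Independent G S) where

    ⊕-preserves-edges : ∀ {u v} → adj G u v ≡ true → adj (G ⊕ S) u v ≡ true
    ⊕-preserves-edges {u} {v} u∼v with S u in su | S v in sv
    ... | false | _     = trans (⊕-unchangedˡ su) u∼v
    ... | true  | false = trans (⊕-unchangedʳ sv) u∼v
    ... | true  | true  with trans (sym u∼v) (independent u v su sv)
    ...   | ()

    ⊕-joins : ∀ {u v} → u ≢ v → S u ≡ true → S v ≡ true → adj (G ⊕ S) u v ≡ true
    ⊕-joins {u} {v} u≢v u∈S v∈S with u ≟ v
    ... | yes u≡v = ⊥-elim (u≢v u≡v)
    ... | no _ rewrite u∈S | v∈S | independent u v u∈S v∈S = refl

    neighbour-∉ : ∀ {u v} → S u ≡ true → adj G u v ≡ true → S v ≡ false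
    neighbour-∉ {u} {v} u∈S u∼v with S v in sv
    ... | false = refl
    ... | true with trans (sym u∼v) (independent u v u∈S sv)
    ...   | ()

    DiamondOn-⊕ : ∀ {a b c d} → S a ≡ false → DiamondOn G a b c d → DiamondOn (G ⊕ S) a b c d
    DiamondOn-⊕ a∉S D = record
      { a≢b = a≢b ; a≁b = trans (⊕-unchangedˡ a∉S) a≁b
      ; a∼c = ⊕-preserves-edges a∼c ; a∼d = ⊕-preserves-edges a∼d
      ; b∼c = ⊕-preserves-edges b∼c ; b∼d = ⊕-preserves-edges b∼d
      ; c∼d = ⊕-preserves-edges c∼d }
      where open DiamondOn D

∈≢∉ : ∀ {n} {S : VSet n} {u v} → S u ≡ true → S v ≡ false → u ≢ v
∈≢∉ u∈S v∉S refl with trans (sym u∈S) v∉S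
... | ()

module _ {n : ℕ} {G : Graph n} {S : VSet n} (independent : Independent G S)
         (diamond-free : ¬ ContainsInduced diamond (G ⊕ S)) where

  ¬DiamondOn-⊕ : ∀ {a b c d} → ¬ DiamondOn (G ⊕ S) a b c d
  ¬DiamondOn-⊕ D = diamond-free (_ , DiamondOn⇒IsInducedCopy D)

  DiamondOn⇒∈ : ∀ {a b c d} → DiamondOn G a b c d → S a ≡ true
  DiamondOn⇒∈ {a} D with S a in a∉S
  ... | true  = refl
  ... | false = ⊥-elim (¬DiamondOn-⊕ (DiamondOn-⊕ G S independent a∉S D))

  DiamondDeg2⇒∈ : ∀ {v} → DiamondDeg2 G v → S v ≡ true
  DiamondDeg2⇒∈ (f , copy , inj₁ refl) = DiamondOn⇒∈ (IsInducedCopy⇒DiamondOn copy)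
  DiamondDeg2⇒∈ (f , copy , inj₂ refl) = DiamondOn⇒∈ (DiamondOn-swap (IsInducedCopy⇒DiamondOn copy))

  ∈⇒DiamondDeg2 : ContainsInduced diamond G → ∀ {v} → S v ≡ true → DiamondDeg2 G v
  ∈⇒DiamondDeg2 (f , copy) {v} v∈S with v ≟ f zero | v ≟ f (suc zero)
  ... | yes refl | _        = f , copy , inj₁ refl
  ... | no _     | yes refl = f , copy , inj₂ refl
  ... | no v≢a   | no v≢b   = by-adjacency-to-c-d (adj G v c) (adj G v d) refl refl
    where
    a = f zero
    b = f (suc zero)
    c = f (suc (suc zero))
    d = f (suc (suc (suc zero)))
    D : DiamondOn G a b c d
    D = IsInducedCopy⇒DiamondOn copy
    open DiamondOn D
    a∈S = DiamondOn⇒∈ D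
    b∈S = DiamondOn⇒∈ (DiamondOn-swap D)
    c∉S = neighbour-∉ G S independent a∈S a∼c
    d∉S = neighbour-∉ G S independent a∈S a∼d
    kept : ∀ {u w} → adj G u w ≡ true → adj (G ⊕ S) u w ≡ true
    kept = ⊕-preserves-edges G S independent
    v∼a : adj (G ⊕ S) v a ≡ true
    v∼a = ⊕-joins G S independent v≢a v∈S a∈S

    by-adjacency-to-c-d : ∀ x y → adj G v c ≡ x → adj G v d ≡ y → DiamondDeg2 G v
    by-adjacency-to-c-d true true v∼c v∼d =
      _ , DiamondOn⇒IsInducedCopy {K = G} {v} {a} {c} {d} record
        { a≢b = v≢a ; a≁b = independent v a v∈S a∈S ; a∼c = v∼c ; a∼d = v∼d
        ; b∼c = a∼c ; b∼d = a∼d ; c∼d = c∼d }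
        , inj₁ refl
    by-adjacency-to-c-d true false v∼c v≁d = ⊥-elim (¬DiamondOn-⊕ {v} {d} {a} {c} record
      { a≢b = ∈≢∉ v∈S d∉S ; a≁b = trans (⊕-unchangedʳ G S d∉S) v≁d
      ; a∼c = v∼a ; a∼d = kept v∼c
      ; b∼c = kept (adj-flip G a∼d) ; b∼d = kept (adj-flip G c∼d) ; c∼d = kept a∼c })
    by-adjacency-to-c-d false true v≁c v∼d = ⊥-elim (¬DiamondOn-⊕ {v} {c} {a} {d} record
      { a≢b = ∈≢∉ v∈S c∉S ; a≁b = trans (⊕-unchangedʳ G S c∉S) v≁c
      ; a∼c = v∼a ; a∼d = kept v∼d
      ; b∼c = kept (adj-flip G a∼c) ; b∼d = kept c∼d ; c∼d = kept a∼d })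
    by-adjacency-to-c-d false false v≁c _ = ⊥-elim (¬DiamondOn-⊕ {v} {c} {a} {b} record
      { a≢b = ∈≢∉ v∈S c∉S ; a≁b = trans (⊕-unchangedʳ G S c∉S) v≁c
      ; a∼c = v∼a ; a∼d = ⊕-joins G S independent v≢b v∈S b∈S
      ; b∼c = kept (adj-flip G a∼c) ; b∼d = kept (adj-flip G b∼c)
      ; c∼d = ⊕-joins G S independent a≢b a∈S b∈S })

lemma2 : (t : ℕ) → t ≥ 3 → (n : ℕ) → (G : Graph n) → ContainsInduced diamond G →
    (S : VSet n) → Independent G S → StarDiamondFree t (G ⊕ S) →
    (v : Fin n) → (S v ≡ true) ⇔ DiamondDeg2 G v
lemma2 _ _ _ G has-diamond S independent (_ , diamond-free) v =
  mk⇔ (∈⇒DiamondDeg2 independent diamond-free has-diamond) (DiamondDeg2⇒∈ independent diamond-free)
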